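{- Let $n\ge 2$ and let $\alpha_0,\dots,\alpha_{n-2}$ be integers, not all of which are even. Let $\mathbf{a},\mathbf{b}$ be non-commuting variables, $\mathbf{c}=\mathbf{a}+\mathbf{b}$ and $\mathbf{d}=\mathbf{a}\mathbf{b}+\mathbf{b}\mathbf{a}$. When the polynomial $\sum_{i=0}^{n-2}\alpha_i\cdot\mathbf{c}^i\,\mathbf{d}\,\mathbf{c}^{n-i-2}$ is expanded in $\mathbb{Z}\langle\mathbf{a},\mathbf{b}\rangle$ as a linear combination of the $2^n$ monomials of degree $n$ in $\mathbf{a},\mathbf{b}$, exactly half of these coefficients (i.e. $2^{n-1}$ of them) are odd. -}

module Defs where

open import Data.Bool using (Bool; true; false)
import Data.Bool as B
open import Data.Nat using (ℕ; zero; suc; _∸_)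
import Data.Nat.Divisibility as ND
open import Data.Integer using (ℤ; ∣_∣; 1ℤ; 0ℤ) renaming (_+_ to _+ℤ_; _*_ to _*ℤ_)
open import Data.List using (List; []; _∷_; _++_; map; concatMap; foldr; filter; length)
open import Data.List.Properties using (≡-dec)
open import Data.Fin using (Fin; toℕ)
open import Data.List using (allFin)
open import Data.Product using (_×_; _,_)
open import Relation.Nullary using (¬?; yes; no)

-- Monomials in the non-commuting variables a, b: words over Bool
-- (false = a, true = b).
Word : Set
Word = List Bool

-- Elements of ℤ⟨a,b⟩ as formal finite sums of (coefficient, monomial);
-- equality of polynomials is equality of all coefficients (see coeff).
Poly : Set
Poly = List (ℤ × Word)

_+ₚ_ : Poly → Poly → Poly
p +ₚ q = p ++ q

_·ₚ_ : ℤ → Poly → Poly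
k ·ₚ p = map (λ { (c , w) → (k *ℤ c , w) }) p

_*ₚ_ : Poly → Poly → Poly
p *ₚ q = concatMap (λ { (c , w) → map (λ { (c' , w') → (c *ℤ c' , w ++ w') }) q }) p

0ₚ 1ₚ : Poly
0ₚ = []
1ₚ = (1ℤ , []) ∷ []

_^ₚ_ : Poly → ℕ → Poly
p ^ₚ zero = 1ₚ
p ^ₚ suc k = p *ₚ (p ^ₚ k)

𝐚 𝐛 𝐜 𝐝 : Poly
𝐚 = (1ℤ , false ∷ []) ∷ []
𝐛 = (1ℤ , true ∷ []) ∷ []
𝐜 = 𝐚 +ₚ 𝐛
𝐝 = (𝐚 *ₚ 𝐛) +ₚ (𝐛 *ₚ 𝐚)

coeff : Poly → Word → ℤ
coeff [] w = 0ℤ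
coeff ((c , v) ∷ p) w with ≡-dec B._≟_ v w
... | yes _ = c +ℤ coeff p w
... | no _ = coeff p w

words : ℕ → List Word
words zero = [] ∷ []
words (suc n) = map (false ∷_) (words n) ++ map (true ∷_) (words n)

Odd : ℤ → Set
Odd z = ¬ (2 ND.∣ ∣ z ∣)
  where open import Relation.Nullary using (¬_)

oddCoeffCount : ℕ → Poly → ℕ
oddCoeffCount n p = length (filter (λ w → ¬? (2 ND.∣? ∣ coeff p w ∣)) (words n))

P : (n : ℕ) → (Fin (n ∸ 1) → ℤ) → Poly
P n α = foldr _+ₚ_ 0ₚ
  (map (λ i → α i ·ₚ ((𝐜 ^ₚ toℕ i) *ₚ (𝐝 *ₚ (𝐜 ^ₚ (n ∸ toℕ i ∸ 2))))) (allFin (n ∸ 1)))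

-- The coefficient of a word w of length n in cⁱ d cʲ is 1 if w changes letter between positions
-- i and i+1, and 0 otherwise. So the parity of the coefficient of w in the sum is the 𝔽₂-linear
-- form ⟨β, Δw⟩, where β = (αᵢ mod 2) ≠ 0 and Δw = (wᵢ + wᵢ₊₁)ᵢ is the difference word of w. Among
-- the words with a fixed first letter, Δw runs once through 𝔽₂ⁿ⁻¹, and a nonzero linear form is 1
-- on exactly half of 𝔽₂ⁿ⁻¹; this gives 2 · 2ⁿ⁻² = 2ⁿ⁻¹ odd coefficients.

module Submission where

open import Defs
open import Data.Bool using (Bool; true; false; _xor_; if_then_else_)
import Data.Bool as B
open import Data.Nat as ℕ using (ℕ; zero; suc; _+_; _^_; _∸_; _≤_; _<_; s≤s; parity)
import Data.Nat.Properties as ℕ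
open import Data.Nat.Divisibility using (_∣_; divides; _∣?_; _∣0; ∣-refl; ∣m∣n⇒∣m+n)
open import Data.Integer using (ℤ; +_; -[1+_]; _⊖_; ∣_∣; 0ℤ; 1ℤ) renaming (_+_ to _+ℤ_; _*_ to _*ℤ_)
import Data.Integer.Properties as ℤ
open import Data.Parity.Base as ℙ using (Parity; 0ℙ; 1ℙ; _⁻¹)
import Data.Parity.Properties as ℙ
open import Data.Fin as Fin using (Fin; toℕ)
open import Data.Fin.Properties using (toℕ<n)
open import Data.List using (List; []; _∷_; _++_; map; foldr; filter; length; tabulate; allFin)
import Data.List.Properties as List
open import Data.List.Properties using (≡-dec)
open import Data.List.Membership.Propositional using (_∈_)
open import Data.List.Membership.Propositional.Properties using (∈-tabulate⁺)
open import Data.List.Relation.Unary.Any using (there)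
open import Data.Product using (∃; _×_; _,_)
open import Function using (_∘_; id)
open import Relation.Unary using (_≐_)
open import Relation.Binary.PropositionalEquality
open import Relation.Nullary using (¬_; Dec; yes; no; ¬?; contradiction)

-- Parity of natural numbers and integers

2∣⇒parity≡0ℙ : ∀ {n} → 2 ∣ n → parity n ≡ 0ℙ
2∣⇒parity≡0ℙ (divides q refl) = trans (ℙ.*-homo-* q 2) (ℙ.*-zeroʳ (parity q))

parity≡0ℙ⇒2∣ : ∀ n → parity n ≡ 0ℙ → 2 ∣ n
parity≡0ℙ⇒2∣ zero          _  = 2 ∣0
parity≡0ℙ⇒2∣ (suc (suc n)) eq = ∣m∣n⇒∣m+n ∣-refl (parity≡0ℙ⇒2∣ n eq)

¬2∣⇒parity≡1ℙ : ∀ n → ¬ 2 ∣ n → parity n ≡ 1ℙ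
¬2∣⇒parity≡1ℙ n 2∤n with parity n in eq
... | 0ℙ = contradiction (parity≡0ℙ⇒2∣ n eq) 2∤n
... | 1ℙ = refl

parity≡1ℙ⇒¬2∣ : ∀ {n} → parity n ≡ 1ℙ → ¬ 2 ∣ n
parity≡1ℙ⇒¬2∣ eq 2∣n with () ← trans (sym (2∣⇒parity≡0ℙ 2∣n)) eq

parityℤ : ℤ → Parity
parityℤ z = parity ∣ z ∣

parity-suc-+-suc : ∀ m n → parity (suc m) ℙ.+ parity (suc n) ≡ parity m ℙ.+ parity n
parity-suc-+-suc m n = begin
  parity (suc m) ℙ.+ parity (suc n) ≡⟨ ℙ.+-homo-+ (suc m) (suc n) ⟨
  parity (suc m + suc n)            ≡⟨ cong parity (ℕ.+-suc (suc m) n) ⟩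
  parity (m + n)                    ≡⟨ ℙ.+-homo-+ m n ⟩
  parity m ℙ.+ parity n             ∎
  where open ≡-Reasoning

parity-∣⊖∣ : ∀ m n → parity ∣ m ⊖ n ∣ ≡ parity m ℙ.+ parity n
parity-∣⊖∣ m       zero    = sym (ℙ.+-identityʳ (parity m))
parity-∣⊖∣ zero    (suc n) = refl
parity-∣⊖∣ (suc m) (suc n) = begin
  parity ∣ suc m ⊖ suc n ∣          ≡⟨ cong (parity ∘ ∣_∣) (ℤ.[1+m]⊖[1+n]≡m⊖n m n) ⟩
  parity ∣ m ⊖ n ∣                  ≡⟨ parity-∣⊖∣ m n ⟩
  parity m ℙ.+ parity n             ≡⟨ parity-suc-+-suc m n ⟨
  parity (suc m) ℙ.+ parity (suc n) ∎
  where open ≡-Reasoning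

parityℤ-homo-+ : ∀ i j → parityℤ (i +ℤ j) ≡ parityℤ i ℙ.+ parityℤ j
parityℤ-homo-+ (+ m)    (+ n)    = ℙ.+-homo-+ m n
parityℤ-homo-+ (+ m)    -[1+ n ] = parity-∣⊖∣ m (suc n)
parityℤ-homo-+ -[1+ m ] (+ n)    = trans (parity-∣⊖∣ n (suc m)) (ℙ.+-comm (parity n) _)
parityℤ-homo-+ -[1+ m ] -[1+ n ] = trans (ℙ.+-homo-+ m n) (sym (parity-suc-+-suc m n))

parityℤ-homo-* : ∀ i j → parityℤ (i *ℤ j) ≡ parityℤ i ℙ.* parityℤ j
parityℤ-homo-* i j = trans (cong parity (ℤ.abs-* i j)) (ℙ.*-homo-* ∣ i ∣ ∣ j ∣)

-- Coefficients in ℤ⟨a,b⟩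

-- p *ₚ q reduces to concatMap (_⋆ q) p.
_⋆_ : ℤ × Word → Poly → Poly
(c , u) ⋆ q = map (λ (c′ , v) → (c *ℤ c′ , u ++ v)) q

letter : Bool → Poly
letter x = (1ℤ , x ∷ []) ∷ []

coeff-∷-≡ : ∀ c w p → coeff ((c , w) ∷ p) w ≡ c +ℤ coeff p w
coeff-∷-≡ c w p with ≡-dec B._≟_ w w
... | yes _   = refl
... | no w≢w = contradiction refl w≢w

coeff-∷-≢ : ∀ c v p {w} → v ≢ w → coeff ((c , v) ∷ p) w ≡ coeff p w
coeff-∷-≢ c v p {w} v≢w with ≡-dec B._≟_ v w
... | yes v≡w = contradiction v≡w v≢w
... | no _    = refl

coeff-++ : ∀ p q w → coeff (p ++ q) w ≡ coeff p w +ℤ coeff q w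
coeff-++ []            q w = sym (ℤ.+-identityˡ (coeff q w))
coeff-++ ((c , v) ∷ p) q w with ≡-dec B._≟_ v w
... | yes _ = trans (cong (c +ℤ_) (coeff-++ p q w)) (sym (ℤ.+-assoc c _ _))
... | no _  = coeff-++ p q w

coeff-· : ∀ k p w → coeff (k ·ₚ p) w ≡ k *ℤ coeff p w
coeff-· k []            w = sym (ℤ.*-zeroʳ k)
coeff-· k ((c , v) ∷ p) w with ≡-dec B._≟_ v w
... | yes _ = trans (cong (k *ℤ c +ℤ_) (coeff-· k p w)) (sym (ℤ.*-distribˡ-+ k c _))
... | no _  = coeff-· k p w

coeff-letter*-∷ : ∀ x q w → coeff (letter x *ₚ q) (x ∷ w) ≡ coeff q w
coeff-letter*-∷ x []            w = refl
coeff-letter*-∷ x ((c , v) ∷ q) w = by-cases (≡-dec B._≟_ v w)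
  where
  open ≡-Reasoning
  by-cases : Dec (v ≡ w) → coeff (letter x *ₚ ((c , v) ∷ q)) (x ∷ w) ≡ coeff ((c , v) ∷ q) w
  by-cases (yes refl) = begin
    coeff ((1ℤ *ℤ c , x ∷ v) ∷ (letter x *ₚ q)) (x ∷ v)
      ≡⟨ coeff-∷-≡ (1ℤ *ℤ c) (x ∷ v) (letter x *ₚ q) ⟩
    1ℤ *ℤ c +ℤ coeff (letter x *ₚ q) (x ∷ v)
      ≡⟨ cong₂ _+ℤ_ (ℤ.*-identityˡ c) (coeff-letter*-∷ x q v) ⟩
    c +ℤ coeff q v
      ≡⟨ coeff-∷-≡ c v q ⟨
    coeff ((c , v) ∷ q) v ∎
  by-cases (no v≢w) = begin
    coeff ((1ℤ *ℤ c , x ∷ v) ∷ (letter x *ₚ q)) (x ∷ w)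
      ≡⟨ coeff-∷-≢ (1ℤ *ℤ c) (x ∷ v) (letter x *ₚ q) (v≢w ∘ List.∷-injectiveʳ) ⟩
    coeff (letter x *ₚ q) (x ∷ w)
      ≡⟨ coeff-letter*-∷ x q w ⟩
    coeff q w
      ≡⟨ coeff-∷-≢ c v q v≢w ⟨
    coeff ((c , v) ∷ q) w ∎

coeff-letter*-≢ : ∀ {x y} q w → x ≢ y → coeff (letter x *ₚ q) (y ∷ w) ≡ 0ℤ
coeff-letter*-≢ []            w x≢y = refl
coeff-letter*-≢ {x} ((c , v) ∷ q) w x≢y =
  trans (coeff-∷-≢ (1ℤ *ℤ c) (x ∷ v) (letter x *ₚ q) (x≢y ∘ List.∷-injectiveˡ))
        (coeff-letter*-≢ q w x≢y)

*ₚ-distribʳ-++ : ∀ p p′ q → (p ++ p′) *ₚ q ≡ p *ₚ q ++ p′ *ₚ q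
*ₚ-distribʳ-++ p p′ q = List.concatMap-++ (_⋆ q) p p′

⋆-⋆ : ∀ c u c′ v r → (c , u) ⋆ ((c′ , v) ⋆ r) ≡ (c *ℤ c′ , u ++ v) ⋆ r
⋆-⋆ c u c′ v []            = refl
⋆-⋆ c u c′ v ((d , t) ∷ r) =
  cong₂ _∷_ (cong₂ _,_ (sym (ℤ.*-assoc c c′ d)) (sym (List.++-assoc u v t))) (⋆-⋆ c u c′ v r)

⋆-*ₚ : ∀ c u q r → ((c , u) ⋆ q) *ₚ r ≡ (c , u) ⋆ (q *ₚ r)
⋆-*ₚ c u []             r = refl
⋆-*ₚ c u ((c′ , v) ∷ q) r = begin
  (c *ℤ c′ , u ++ v) ⋆ r ++ ((c , u) ⋆ q) *ₚ r
    ≡⟨ cong₂ _++_ (sym (⋆-⋆ c u c′ v r)) (⋆-*ₚ c u q r) ⟩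
  (c , u) ⋆ ((c′ , v) ⋆ r) ++ (c , u) ⋆ (q *ₚ r)
    ≡⟨ List.map-++ _ ((c′ , v) ⋆ r) (q *ₚ r) ⟨
  (c , u) ⋆ ((c′ , v) ⋆ r ++ q *ₚ r) ∎
  where open ≡-Reasoning

*ₚ-assoc : ∀ p q r → (p *ₚ q) *ₚ r ≡ p *ₚ (q *ₚ r)
*ₚ-assoc []            q r = refl
*ₚ-assoc ((c , u) ∷ p) q r = begin
  ((c , u) ⋆ q ++ p *ₚ q) *ₚ r          ≡⟨ *ₚ-distribʳ-++ ((c , u) ⋆ q) (p *ₚ q) r ⟩
  ((c , u) ⋆ q) *ₚ r ++ (p *ₚ q) *ₚ r   ≡⟨ cong₂ _++_ (⋆-*ₚ c u q r) (*ₚ-assoc p q r) ⟩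
  (c , u) ⋆ (q *ₚ r) ++ p *ₚ (q *ₚ r)   ∎
  where open ≡-Reasoning

*ₚ-identityˡ : ∀ p → 1ₚ *ₚ p ≡ p
*ₚ-identityˡ p = trans (List.++-identityʳ ((1ℤ , []) ⋆ p)) (1⋆ p)
  where
  1⋆ : ∀ p → (1ℤ , []) ⋆ p ≡ p
  1⋆ []            = refl
  1⋆ ((c , v) ∷ p) = cong₂ _∷_ (cong (_, v) (ℤ.*-identityˡ c)) (1⋆ p)

coeff-𝐜* : ∀ q y w → coeff (𝐜 *ₚ q) (y ∷ w) ≡ coeff q w
coeff-𝐜* q y w = begin
  coeff (𝐜 *ₚ q) (y ∷ w)
    ≡⟨ cong (λ p → coeff p (y ∷ w)) (*ₚ-distribʳ-++ 𝐚 𝐛 q) ⟩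
  coeff (𝐚 *ₚ q ++ 𝐛 *ₚ q) (y ∷ w)
    ≡⟨ coeff-++ (𝐚 *ₚ q) (𝐛 *ₚ q) (y ∷ w) ⟩
  coeff (𝐚 *ₚ q) (y ∷ w) +ℤ coeff (𝐛 *ₚ q) (y ∷ w)
    ≡⟨ by-letter y ⟩
  coeff q w ∎
  where
  open ≡-Reasoning
  by-letter : ∀ y → coeff (𝐚 *ₚ q) (y ∷ w) +ℤ coeff (𝐛 *ₚ q) (y ∷ w) ≡ coeff q w
  by-letter false = trans (cong₂ _+ℤ_ (coeff-letter*-∷ false q w) (coeff-letter*-≢ q w λ ()))
                          (ℤ.+-identityʳ (coeff q w))
  by-letter true  = trans (cong₂ _+ℤ_ (coeff-letter*-≢ q w λ ()) (coeff-letter*-∷ true q w))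
                          (ℤ.+-identityˡ (coeff q w))

coeff-𝐝* : ∀ q x y w → coeff (𝐝 *ₚ q) (x ∷ y ∷ w) ≡ (if x xor y then coeff q w else 0ℤ)
coeff-𝐝* q x y w = begin
  coeff (𝐝 *ₚ q) (x ∷ y ∷ w)
    ≡⟨ cong (λ p → coeff p (x ∷ y ∷ w)) 𝐝*q≡ ⟩
  coeff (𝐚 *ₚ (𝐛 *ₚ q) ++ 𝐛 *ₚ (𝐚 *ₚ q)) (x ∷ y ∷ w)
    ≡⟨ coeff-++ (𝐚 *ₚ (𝐛 *ₚ q)) (𝐛 *ₚ (𝐚 *ₚ q)) (x ∷ y ∷ w) ⟩
  coeff (𝐚 *ₚ (𝐛 *ₚ q)) (x ∷ y ∷ w) +ℤ coeff (𝐛 *ₚ (𝐚 *ₚ q)) (x ∷ y ∷ w)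
    ≡⟨ by-letters x y ⟩
  (if x xor y then coeff q w else 0ℤ) ∎
  where
  open ≡-Reasoning
  𝐝*q≡ : 𝐝 *ₚ q ≡ 𝐚 *ₚ (𝐛 *ₚ q) ++ 𝐛 *ₚ (𝐚 *ₚ q)
  𝐝*q≡ = trans (*ₚ-distribʳ-++ (𝐚 *ₚ 𝐛) (𝐛 *ₚ 𝐚) q) (cong₂ _++_ (*ₚ-assoc 𝐚 𝐛 q) (*ₚ-assoc 𝐛 𝐚 q))
  by-letters : ∀ x y → coeff (𝐚 *ₚ (𝐛 *ₚ q)) (x ∷ y ∷ w) +ℤ coeff (𝐛 *ₚ (𝐚 *ₚ q)) (x ∷ y ∷ w)
                     ≡ (if x xor y then coeff q w else 0ℤ)
  by-letters false false = cong₂ _+ℤ_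
    (trans (coeff-letter*-∷ false (𝐛 *ₚ q) (false ∷ w)) (coeff-letter*-≢ q w λ ()))
    (coeff-letter*-≢ (𝐚 *ₚ q) (false ∷ w) λ ())
  by-letters false true  = trans (cong₂ _+ℤ_
    (trans (coeff-letter*-∷ false (𝐛 *ₚ q) (true ∷ w)) (coeff-letter*-∷ true q w))
    (coeff-letter*-≢ (𝐚 *ₚ q) (true ∷ w) λ ()))
    (ℤ.+-identityʳ (coeff q w))
  by-letters true  false = trans (cong₂ _+ℤ_
    (coeff-letter*-≢ (𝐛 *ₚ q) (false ∷ w) λ ())
    (trans (coeff-letter*-∷ true (𝐚 *ₚ q) (false ∷ w)) (coeff-letter*-∷ false q w)))
    (ℤ.+-identityˡ (coeff q w))
  by-letters true  true  = cong₂ _+ℤ_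
    (coeff-letter*-≢ (𝐛 *ₚ q) (true ∷ w) λ ())
    (trans (coeff-letter*-∷ true (𝐚 *ₚ q) (true ∷ w)) (coeff-letter*-≢ q w λ ()))

coeff-𝐜^ : ∀ w → coeff (𝐜 ^ₚ length w) w ≡ 1ℤ
coeff-𝐜^ []      = refl
coeff-𝐜^ (y ∷ w) = trans (coeff-𝐜* (𝐜 ^ₚ length w) y w) (coeff-𝐜^ w)

differsAt : ℕ → Word → Bool
differsAt zero    (x ∷ y ∷ _) = x xor y
differsAt zero    _           = false
differsAt (suc i) []          = false
differsAt (suc i) (_ ∷ w)     = differsAt i w

coeff-𝐜^*𝐝*𝐜^ : ∀ i j w → length w ≡ i + suc (suc j) →
                coeff ((𝐜 ^ₚ i) *ₚ (𝐝 *ₚ (𝐜 ^ₚ j))) w ≡ (if differsAt i w then 1ℤ else 0ℤ)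
coeff-𝐜^*𝐝*𝐜^ zero    j (x ∷ y ∷ w) refl = begin
  coeff (1ₚ *ₚ (𝐝 *ₚ (𝐜 ^ₚ length w))) (x ∷ y ∷ w)
    ≡⟨ cong (λ p → coeff p (x ∷ y ∷ w)) (*ₚ-identityˡ (𝐝 *ₚ (𝐜 ^ₚ length w))) ⟩
  coeff (𝐝 *ₚ (𝐜 ^ₚ length w)) (x ∷ y ∷ w)
    ≡⟨ coeff-𝐝* (𝐜 ^ₚ length w) x y w ⟩
  (if x xor y then coeff (𝐜 ^ₚ length w) w else 0ℤ)
    ≡⟨ cong (λ z → if x xor y then z else 0ℤ) (coeff-𝐜^ w) ⟩
  (if x xor y then 1ℤ else 0ℤ) ∎
  where open ≡-Reasoning
coeff-𝐜^*𝐝*𝐜^ (suc i) j (x ∷ w)     eq   = begin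
  coeff ((𝐜 *ₚ (𝐜 ^ₚ i)) *ₚ (𝐝 *ₚ (𝐜 ^ₚ j))) (x ∷ w)
    ≡⟨ cong (λ p → coeff p (x ∷ w)) (*ₚ-assoc 𝐜 (𝐜 ^ₚ i) (𝐝 *ₚ (𝐜 ^ₚ j))) ⟩
  coeff (𝐜 *ₚ ((𝐜 ^ₚ i) *ₚ (𝐝 *ₚ (𝐜 ^ₚ j)))) (x ∷ w)
    ≡⟨ coeff-𝐜* ((𝐜 ^ₚ i) *ₚ (𝐝 *ₚ (𝐜 ^ₚ j))) x w ⟩
  coeff ((𝐜 ^ₚ i) *ₚ (𝐝 *ₚ (𝐜 ^ₚ j))) w
    ≡⟨ coeff-𝐜^*𝐝*𝐜^ i j w (ℕ.suc-injective eq) ⟩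
  (if differsAt i w then 1ℤ else 0ℤ) ∎
  where open ≡-Reasoning

-- Counting words

toParity : Bool → Parity
toParity false = 0ℙ
toParity true  = 1ℙ

differencesFrom : Bool → Word → Word
differencesFrom x []      = []
differencesFrom x (y ∷ w) = (x xor y) ∷ differencesFrom y w

differences : Word → Word
differences []      = []
differences (x ∷ w) = differencesFrom x w

dot : List Parity → Word → Parity
dot (b ∷ β) (x ∷ v) = b ℙ.* toParity x ℙ.+ dot β v
dot _       _       = 0ℙ

count : (Word → Parity) → List Word → ℕ
count f ws = length (filter (λ w → f w ℙ.≟ 1ℙ) ws)

count-++ : ∀ f xs ys → count f (xs ++ ys) ≡ count f xs + count f ys
count-++ f xs ys = trans (cong length (List.filter-++ (λ w → f w ℙ.≟ 1ℙ) xs ys))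
                         (List.length-++ (filter (λ w → f w ℙ.≟ 1ℙ) xs))

count-map : ∀ f g xs → count f (map g xs) ≡ count (f ∘ g) xs
count-map f g []       = refl
count-map f g (x ∷ xs) with f (g x) ℙ.≟ 1ℙ
... | yes _ = cong suc (count-map f g xs)
... | no _  = count-map f g xs

count-words-suc : ∀ f n →
  count f (words (suc n)) ≡ count (f ∘ (false ∷_)) (words n) + count (f ∘ (true ∷_)) (words n)
count-words-suc f n = trans (count-++ f (map (false ∷_) (words n)) (map (true ∷_) (words n)))
                            (cong₂ _+_ (count-map f (false ∷_) (words n)) (count-map f (true ∷_) (words n)))

count-cong-words : ∀ n {f g} → (∀ w → length w ≡ n → f w ≡ g w) →
                   count f (words n) ≡ count g (words n)
count-cong-words zero {f} {g} f≗g with f [] | g [] | f≗g [] refl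
... | 0ℙ | _ | refl = refl
... | 1ℙ | _ | refl = refl
count-cong-words (suc n) {f} {g} f≗g = begin
  count f (words (suc n))
    ≡⟨ count-words-suc f n ⟩
  count (f ∘ (false ∷_)) (words n) + count (f ∘ (true ∷_)) (words n)
    ≡⟨ cong₂ _+_ (count-cong-words n (λ w eq → f≗g (false ∷ w) (cong suc eq)))
                 (count-cong-words n (λ w eq → f≗g (true ∷ w) (cong suc eq))) ⟩
  count (g ∘ (false ∷_)) (words n) + count (g ∘ (true ∷_)) (words n)
    ≡⟨ count-words-suc g n ⟨
  count g (words (suc n)) ∎
  where open ≡-Reasoning

count+count-complement : ∀ f ws → count f ws + count (λ w → f w ⁻¹) ws ≡ length ws
count+count-complement f []       = refl
count+count-complement f (w ∷ ws) with f w
... | 0ℙ = trans (ℕ.+-suc (count f ws) _) (cong suc (count+count-complement f ws))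
... | 1ℙ = cong suc (count+count-complement f ws)

length-words : ∀ n → length (words n) ≡ 2 ^ n
length-words zero    = refl
length-words (suc n) = begin
  length (map (false ∷_) (words n) ++ map (true ∷_) (words n))
    ≡⟨ List.length-++ (map (false ∷_) (words n)) ⟩
  length (map (false ∷_) (words n)) + length (map (true ∷_) (words n))
    ≡⟨ cong₂ _+_ (List.length-map (false ∷_) (words n)) (List.length-map (true ∷_) (words n)) ⟩
  length (words n) + length (words n)
    ≡⟨ cong₂ _+_ (length-words n) (trans (length-words n) (sym (ℕ.+-identityʳ (2 ^ n)))) ⟩
  2 ^ suc n ∎
  where open ≡-Reasoning

count-∘-differencesFrom : ∀ n g x → count (g ∘ differencesFrom x) (words n) ≡ count g (words n)
count-∘-differencesFrom zero    g x = count-cong-words zero {g ∘ differencesFrom x} {g} λ { [] _ → refl }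
count-∘-differencesFrom (suc n) g x = begin
  count (g ∘ differencesFrom x) (words (suc n))
    ≡⟨ count-words-suc (g ∘ differencesFrom x) n ⟩
  count (g ∘ ((x xor false) ∷_) ∘ differencesFrom false) (words n)
    + count (g ∘ ((x xor true) ∷_) ∘ differencesFrom true) (words n)
    ≡⟨ cong₂ _+_ (count-∘-differencesFrom n (g ∘ ((x xor false) ∷_)) false)
                 (count-∘-differencesFrom n (g ∘ ((x xor true) ∷_)) true) ⟩
  count (g ∘ ((x xor false) ∷_)) (words n) + count (g ∘ ((x xor true) ∷_)) (words n)
    ≡⟨ by-first-letter x ⟩
  count (g ∘ (false ∷_)) (words n) + count (g ∘ (true ∷_)) (words n)
    ≡⟨ count-words-suc g n ⟨
  count g (words (suc n)) ∎
  where
  open ≡-Reasoning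
  by-first-letter : ∀ x →
    count (g ∘ ((x xor false) ∷_)) (words n) + count (g ∘ ((x xor true) ∷_)) (words n) ≡
    count (g ∘ (false ∷_)) (words n) + count (g ∘ (true ∷_)) (words n)
  by-first-letter false = refl
  by-first-letter true  = ℕ.+-comm (count (g ∘ (true ∷_)) (words n)) _

dot-balanced : ∀ β → 1ℙ ∈ β →
               count (dot β) (words (length β)) + count (dot β) (words (length β)) ≡ 2 ^ length β
dot-balanced (b ∷ β) 1ℙ∈b∷β =
  cong₂ _+_ (half b 1ℙ∈b∷β) (trans (half b 1ℙ∈b∷β) (sym (ℕ.+-identityʳ (2 ^ length β))))
  where
  open ≡-Reasoning
  half : ∀ b → 1ℙ ∈ b ∷ β → count (dot (b ∷ β)) (words (suc (length β))) ≡ 2 ^ length β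
  half 1ℙ _ = begin
    count (dot (1ℙ ∷ β)) (words (suc (length β)))
      ≡⟨ count-words-suc (dot (1ℙ ∷ β)) (length β) ⟩
    count (dot β) (words (length β)) + count (λ w → dot β w ⁻¹) (words (length β))
      ≡⟨ count+count-complement (dot β) (words (length β)) ⟩
    length (words (length β))
      ≡⟨ length-words (length β) ⟩
    2 ^ length β ∎
  half 0ℙ (there 1ℙ∈β) = trans (count-words-suc (dot (0ℙ ∷ β)) (length β)) (dot-balanced β 1ℙ∈β)

count-dot-differences : ∀ β {m} → length β ≡ m → 1ℙ ∈ β →
                        count (dot β ∘ differences) (words (suc m)) ≡ 2 ^ m
count-dot-differences β {m} refl 1ℙ∈β = begin
  count (dot β ∘ differences) (words (suc m))
    ≡⟨ count-words-suc (dot β ∘ differences) m ⟩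
  count (dot β ∘ differencesFrom false) (words m) + count (dot β ∘ differencesFrom true) (words m)
    ≡⟨ cong₂ _+_ (count-∘-differencesFrom m (dot β) false)
                 (count-∘-differencesFrom m (dot β) true) ⟩
  count (dot β) (words m) + count (dot β) (words m)
    ≡⟨ dot-balanced β 1ℙ∈β ⟩
  2 ^ m ∎
  where open ≡-Reasoning

-- Parity of the coefficients of P

sumℙ : List Parity → Parity
sumℙ = foldr ℙ._+_ 0ℙ

parityℤ-coeff-sum : ∀ ps w →
  parityℤ (coeff (foldr _+ₚ_ 0ₚ ps) w) ≡ sumℙ (map (λ p → parityℤ (coeff p w)) ps)
parityℤ-coeff-sum []       w = refl
parityℤ-coeff-sum (p ∷ ps) w = begin
  parityℤ (coeff (p ++ foldr _+ₚ_ 0ₚ ps) w)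
    ≡⟨ cong parityℤ (coeff-++ p (foldr _+ₚ_ 0ₚ ps) w) ⟩
  parityℤ (coeff p w +ℤ coeff (foldr _+ₚ_ 0ₚ ps) w)
    ≡⟨ parityℤ-homo-+ (coeff p w) _ ⟩
  parityℤ (coeff p w) ℙ.+ parityℤ (coeff (foldr _+ₚ_ 0ₚ ps) w)
    ≡⟨ cong (parityℤ (coeff p w) ℙ.+_) (parityℤ-coeff-sum ps w) ⟩
  parityℤ (coeff p w) ℙ.+ sumℙ (map (λ p → parityℤ (coeff p w)) ps) ∎
  where open ≡-Reasoning

sumℙ-differsAt≡dot : ∀ m (β : Fin m → Parity) x w → length w ≡ m →
  sumℙ (tabulate (λ i → β i ℙ.* toParity (differsAt (toℕ i) (x ∷ w)))) ≡
  dot (tabulate β) (differencesFrom x w)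
sumℙ-differsAt≡dot zero    β x []      refl = refl
sumℙ-differsAt≡dot (suc m) β x (y ∷ w) eq   =
  cong (β Fin.zero ℙ.* toParity (x xor y) ℙ.+_)
       (sumℙ-differsAt≡dot m (β ∘ Fin.suc) y w (ℕ.suc-injective eq))

i+[2+[1+m∸i∸2]]≡1+m : ∀ {i m} → i < m → i + suc (suc (suc m ∸ i ∸ 2)) ≡ suc m
i+[2+[1+m∸i∸2]]≡1+m {zero}  {suc m} _         = refl
i+[2+[1+m∸i∸2]]≡1+m {suc i} {suc m} (s≤s i<m) = cong suc (i+[2+[1+m∸i∸2]]≡1+m i<m)

parityℤ-coeff-P : ∀ m (α : Fin m → ℤ) w → length w ≡ suc m →
                  parityℤ (coeff (P (suc m) α) w) ≡ dot (tabulate (parityℤ ∘ α)) (differences w)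
parityℤ-coeff-P m α (x ∷ w) eq = begin
  parityℤ (coeff (P (suc m) α) (x ∷ w))
    ≡⟨ parityℤ-coeff-sum (map term (allFin m)) (x ∷ w) ⟩
  sumℙ (map (λ p → parityℤ (coeff p (x ∷ w))) (map term (allFin m)))
    ≡⟨ cong sumℙ (sym (List.map-∘ (allFin m))) ⟩
  sumℙ (map (λ i → parityℤ (coeff (term i) (x ∷ w))) (allFin m))
    ≡⟨ cong sumℙ (List.map-tabulate id (λ i → parityℤ (coeff (term i) (x ∷ w)))) ⟩
  sumℙ (tabulate (λ i → parityℤ (coeff (term i) (x ∷ w))))
    ≡⟨ cong sumℙ (List.tabulate-cong parity-term) ⟩
  sumℙ (tabulate (λ i → parityℤ (α i) ℙ.* toParity (differsAt (toℕ i) (x ∷ w))))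
    ≡⟨ sumℙ-differsAt≡dot m (parityℤ ∘ α) x w (ℕ.suc-injective eq) ⟩
  dot (tabulate (parityℤ ∘ α)) (differencesFrom x w) ∎
  where
  open ≡-Reasoning
  𝐜ⁱ𝐝𝐜ʲ : Fin m → Poly
  𝐜ⁱ𝐝𝐜ʲ i = (𝐜 ^ₚ toℕ i) *ₚ (𝐝 *ₚ (𝐜 ^ₚ (suc m ∸ toℕ i ∸ 2)))
  term : Fin m → Poly
  term i = α i ·ₚ 𝐜ⁱ𝐝𝐜ʲ i
  parityℤ-if : ∀ b → parityℤ (if b then 1ℤ else 0ℤ) ≡ toParity b
  parityℤ-if false = refl
  parityℤ-if true  = refl
  parity-term : ∀ i →
    parityℤ (coeff (term i) (x ∷ w)) ≡ parityℤ (α i) ℙ.* toParity (differsAt (toℕ i) (x ∷ w))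
  parity-term i = begin
    parityℤ (coeff (α i ·ₚ 𝐜ⁱ𝐝𝐜ʲ i) (x ∷ w))
      ≡⟨ cong parityℤ (coeff-· (α i) (𝐜ⁱ𝐝𝐜ʲ i) (x ∷ w)) ⟩
    parityℤ (α i *ℤ coeff (𝐜ⁱ𝐝𝐜ʲ i) (x ∷ w))
      ≡⟨ parityℤ-homo-* (α i) (coeff (𝐜ⁱ𝐝𝐜ʲ i) (x ∷ w)) ⟩
    parityℤ (α i) ℙ.* parityℤ (coeff (𝐜ⁱ𝐝𝐜ʲ i) (x ∷ w))
      ≡⟨ cong (λ z → parityℤ (α i) ℙ.* parityℤ z)
              (coeff-𝐜^*𝐝*𝐜^ (toℕ i) _ (x ∷ w) (trans eq (sym (i+[2+[1+m∸i∸2]]≡1+m (toℕ<n i))))) ⟩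
    parityℤ (α i) ℙ.* parityℤ (if differsAt (toℕ i) (x ∷ w) then 1ℤ else 0ℤ)
      ≡⟨ cong (parityℤ (α i) ℙ.*_) (parityℤ-if (differsAt (toℕ i) (x ∷ w))) ⟩
    parityℤ (α i) ℙ.* toParity (differsAt (toℕ i) (x ∷ w)) ∎

oddCoeffCount≡count : ∀ n p → oddCoeffCount n p ≡ count (parityℤ ∘ coeff p) (words n)
oddCoeffCount≡count n p = cong length (List.filter-≐ (λ w → ¬? (2 ∣? ∣ coeff p w ∣))
                                                     (λ w → parityℤ (coeff p w) ℙ.≟ 1ℙ)
                                                     odd≐parity≡1ℙ (words n))
  where
  odd≐parity≡1ℙ : (λ w → Odd (coeff p w)) ≐ (λ w → parityℤ (coeff p w) ≡ 1ℙ)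
  odd≐parity≡1ℙ = (λ {w} → ¬2∣⇒parity≡1ℙ ∣ coeff p w ∣) , parity≡1ℙ⇒¬2∣

proposition4p4 : (n : ℕ) → 2 ≤ n → (α : Fin (n ∸ 1) → ℤ) → ∃ (λ i → Odd (α i))
    → oddCoeffCount n (P n α) ≡ 2 ^ (n ∸ 1)
-- The hypothesis 2 ≤ n is redundant: an index i : Fin (n ∸ 1) already forces n ≥ 2.
proposition4p4 zero    _ _ (() , _)
proposition4p4 (suc m) _ α (i , αᵢ-odd) = begin
  oddCoeffCount (suc m) (P (suc m) α)
    ≡⟨ oddCoeffCount≡count (suc m) (P (suc m) α) ⟩
  count (parityℤ ∘ coeff (P (suc m) α)) (words (suc m))
    ≡⟨ count-cong-words (suc m) (parityℤ-coeff-P m α) ⟩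
  count (dot β ∘ differences) (words (suc m))
    ≡⟨ count-dot-differences β (List.length-tabulate (parityℤ ∘ α)) 1ℙ∈β ⟩
  2 ^ m ∎
  where
  open ≡-Reasoning
  β : List Parity
  β = tabulate (parityℤ ∘ α)
  1ℙ∈β : 1ℙ ∈ β
  1ℙ∈β = subst (_∈ β) (¬2∣⇒parity≡1ℙ ∣ α i ∣ αᵢ-odd) (∈-tabulate⁺ i)
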